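{- Let $X_1,\ldots,X_n$ be pairwise disjoint subsets of $E(M)$ for a matroid $M$, and let $Y_1,\ldots,Y_n$ be pairwise disjoint sets each disjoint from $E(M)$. For a permutation $\phi$ of $[n]$, let $M_{\phi(0)}=M$ and, for each $i\in[n]$, let $M_{\phi(i)}$ be obtained from $M_{\phi(i-1)}$ by freely adding the elements of $Y_{\phi(i)}$ into the guts of $X_{\phi(i)}$; let $M_\phi=M_{\phi(n)}$. Then: (i) if $\psi$ is also a permutation of $[n]$, then $M_\psi=M_\phi$; (ii) for each $i\in[n]$, $M_\phi$ is obtained from $M_\phi\backslash Y_i$ by freely adding the elements of $Y_i$ into the guts of $X_i$.
   Context: For a matroid $N$ with rank function $r$, $\lambda_N(X)=r(X)+r(E(N)-X)-r(N)$. Freely adding $e\notin E(N)$ into the guts of $Z\subseteq E(N)$: the single-element extension $N'$ of $N$ by $e$ such that, for each $X\subseteq E(N)$, $r_{N'}(X\cup\{e\})=r_N(X)$ if $\lambda_{N/X}(Z-X)=0$ and $r_{N'}(X\cup\{e\})=r_N(X)+1$ otherwise. Freely adding a set of elements into the guts of $Z$ means adding them one at a time in this way (each into the guts of $Z$ in the current matroid). -}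

module Defs where

open import Data.Bool using (Bool; true; false; _∧_; _∨_; not; if_then_else_)
open import Data.Nat using (ℕ; suc; _+_; _∸_; _≤_; _≡ᵇ_)
open import Data.List using (List; []; _∷_; length; filterᵇ; map)
open import Data.Bool.ListAction using (any)
open import Data.List.Membership.Propositional using (_∈_; _∉_)
open import Data.List.Relation.Unary.Unique.Propositional using (Unique)
open import Data.Fin using (Fin)
open import Data.Fin.Permutation using (Permutation′; _⟨$⟩ʳ_)
open import Data.Vec.Functional using () renaming (toList to vtoList)
open import Data.Product using (_×_)
open import Function.Bundles using (_⇔_)
open import Relation.Binary.PropositionalEquality using (_≡_; _≢_)

-- Elements of matroids are natural numbers; a (possibly infinite) set of
-- elements is a Boolean predicate on ℕ.
Subset : Set
Subset = ℕ → Bool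

_∪ₛ_ : Subset → Subset → Subset
(X ∪ₛ Y) x = X x ∨ Y x

_∩ₛ_ : Subset → Subset → Subset
(X ∩ₛ Y) x = X x ∧ Y x

_─ₛ_ : Subset → Subset → Subset
(X ─ₛ Y) x = X x ∧ not (Y x)

ofList : List ℕ → Subset
ofList l x = any (λ y → x ≡ᵇ y) l

record RankSys : Set where
  field
    ground : List ℕ
    rk     : Subset → ℕ

open RankSys public

E : RankSys → Subset
E N = ofList (ground N)

card : RankSys → Subset → ℕ
card N X = length (filterᵇ X (ground N))

record IsMatroid (N : RankSys) : Set where
  field
    ground-unique : Unique (ground N)
    rk-cong  : ∀ X Y → (∀ x → x ∈ ground N → X x ≡ Y x) → rk N X ≡ rk N Y
    rk-bound : ∀ X → rk N X ≤ card N X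
    rk-mono  : ∀ X Y → (∀ x → X x ≡ true → Y x ≡ true) → rk N X ≤ rk N Y
    rk-submod : ∀ X Y → rk N (X ∪ₛ Y) + rk N (X ∩ₛ Y) ≤ rk N X + rk N Y

delete : RankSys → Subset → RankSys
delete N Y = record
  { ground = filterᵇ (λ x → not (Y x)) (ground N)
  ; rk     = λ A → rk N (A ─ₛ Y) }

contract : RankSys → Subset → RankSys
contract N X = record
  { ground = filterᵇ (λ x → not (X x)) (ground N)
  ; rk     = λ A → rk N (A ∪ₛ X) ∸ rk N X }

conn : RankSys → Subset → ℕ
conn N X = (rk N X + rk N (E N ─ₛ X)) ∸ rk N (E N)

-- Freely adding e (∉ E(N)) into the guts of Z: the extension N' with
-- E(N') = E(N) ∪ {e}, r_{N'}(A) = r_N(A) for A ⊆ E(N), and, for X ⊆ E(N),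
-- r_{N'}(X ∪ {e}) = r_N(X) if λ_{N/X}(Z - X) = 0 and r_N(X) + 1 otherwise.
freeAdd : RankSys → Subset → ℕ → RankSys
freeAdd N Z e = record
  { ground = e ∷ ground N
  ; rk     = λ A →
      let X = A ∩ₛ E N in
      if A e
      then (if conn (contract N X) (Z ─ₛ X) ≡ᵇ 0
            then rk N X else suc (rk N X))
      else rk N X }

freeAddList : RankSys → Subset → List ℕ → RankSys
freeAddList N Z []       = N
freeAddList N Z (e ∷ es) = freeAddList (freeAdd N Z e) Z es

seqAdd : ∀ {n} → RankSys → (Fin n → Subset) → (Fin n → List ℕ) → List (Fin n) → RankSys
seqAdd N Xs Ys []       = N
seqAdd N Xs Ys (j ∷ js) = seqAdd (freeAddList N (Xs j) (Ys j)) Xs Ys js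

Mperm : ∀ {n} → RankSys → (Fin n → Subset) → (Fin n → List ℕ) → Permutation′ n → RankSys
Mperm M Xs Ys φ = seqAdd M Xs Ys (vtoList (λ i → φ ⟨$⟩ʳ i))

_≅_ : RankSys → RankSys → Set
N₁ ≅ N₂ = (∀ x → (x ∈ ground N₁) ⇔ (x ∈ ground N₂))
        × (∀ X → (∀ x → X x ≡ true → x ∈ ground N₁) → rk N₁ X ≡ rk N₂ X)

-- Adding e freely into the guts of Z gives the rank r′(A) = r(X) + [e ∈ A]·[κ_Z(X) ≠ 0]
-- for X = A ∩ E(N), where κ_Z(X) = λ_{N/X}(Z − X) (connOver N Z X) equals
-- r(Z ∪ X) + r((E − Z) ∪ X) − r(X) − r(E).
-- Submodularity of r makes κ_Z antitone and κ_Z + r submodular, so the extension is again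
-- monotone and submodular and the construction can be iterated. For disjoint Z and Z′,
-- expanding the rank after adding e into the guts of Z and then f into the guts of Z′
-- gives an expression in r and the κ's of N alone which, by the exchange identity
-- κ_Z(X) + κ_{Z′}(Z ∪ X) = κ_{Z′}(X) + κ_Z(Z′ ∪ X), is symmetric in (Z, e) and (Z′, f).
-- So adjacent blocks of additions commute, which gives (i); for (ii), move Y_i to the
-- end and observe that deleting freshly added elements gives back the matroid.
module Submission where

open import Data.Bool using (Bool; true; false; T; _∧_; _∨_; not; if_then_else_)
open import Data.Bool.Properties using (∧-zeroʳ; ∧-identityʳ; ∨-zeroʳ; ∨-assoc; ∨-comm; ∧-distribʳ-∨; ¬-not)
open import Data.Empty using (⊥-elim)
open import Data.Fin using (Fin; _≟_)
open import Data.Fin.Permutation using (Permutation′; _⟨$⟩ʳ_; _⟨$⟩ˡ_; inverseˡ; inverseʳ)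
open import Data.List using (List; []; _∷_; _++_; [_]; filterᵇ)
open import Data.List.Membership.Propositional using (_∈_; _∉_)
open import Data.List.Membership.Propositional.Properties using (∈-tabulate⁺; ∈-∃++)
open import Data.List.Membership.Propositional.Properties.WithK using (unique∧set⇒bag)
open import Data.List.Relation.Binary.BagAndSetEquality using (∼bag⇒↭)
open import Data.List.Relation.Binary.Permutation.Propositional using (_↭_; prep; swap; ↭-trans; ↭⇒↭ₛ)
import Data.List.Relation.Binary.Permutation.Propositional as Perm
open import Data.List.Relation.Binary.Permutation.Propositional.Properties using (shift; ++-comm)
open import Data.List.Relation.Binary.Permutation.Setoid.Properties using (Unique-resp-↭)
open import Data.List.Relation.Unary.All using (All; _∷_; tabulate) renaming (lookup to All-lookup)
open import Data.List.Relation.Unary.AllPairs using (_∷_)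
open import Data.List.Relation.Unary.Any using (here; there)
open import Data.List.Relation.Unary.Unique.Propositional using (Unique)
open import Data.List.Relation.Unary.Unique.Propositional.Properties using (tabulate⁺)
open import Data.Nat using (ℕ; zero; suc; _+_; _∸_; _≤_; _≡ᵇ_; z≤n; s≤s; _≤?_)
open import Data.Nat.Properties
  using (≡ᵇ⇒≡; +-assoc; +-comm; +-identityʳ; suc-injective; m∸n+n≡m; m≤m+n; ≤-trans; ≤-reflexive; ≰⇒>;
         +-mono-≤; +-monoˡ-≤; +-monoʳ-≤; +-cancelʳ-≤; +-cancelʳ-≡; module ≤-Reasoning)
open import Data.Nat.Solver using (module +-*-Solver)
open import Data.Product using (_×_; _,_; ∃-syntax)
open import Data.Sum using (_⊎_; inj₁; inj₂)
open import Data.Unit using (tt)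
open import Data.Vec.Functional using () renaming (toList to vtoList)
open import Function.Bundles using (mk⇔)
open import Relation.Binary.PropositionalEquality using (_≡_; _≢_; refl; sym; trans; cong; cong₂; subst; setoid; module ≡-Reasoning)
open import Relation.Nullary using (yes; no)

open import Defs

open +-*-Solver using (solve; _:+_; _:=_; con)

≡ᵇ-refl : ∀ x → (x ≡ᵇ x) ≡ true
≡ᵇ-refl zero    = refl
≡ᵇ-refl (suc x) = ≡ᵇ-refl x

≡ᵇ-true⇒≡ : ∀ {x y} → (x ≡ᵇ y) ≡ true → x ≡ y
≡ᵇ-true⇒≡ {x} {y} x≡ᵇy = ≡ᵇ⇒≡ x y (subst T (sym x≡ᵇy) tt)

∨-trueʳ : ∀ a {b} → b ≡ true → (a ∨ b) ≡ true
∨-trueʳ a b≡true = trans (cong (a ∨_) b≡true) (∨-zeroʳ a)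

∨-left-comm : ∀ a b c → (a ∨ (b ∨ c)) ≡ (b ∨ (a ∨ c))
∨-left-comm a b c = trans (sym (∨-assoc a b c)) (trans (cong (_∨ c) (∨-comm a b)) (∨-assoc b a c))

∈⇒ofList : ∀ {x l} → x ∈ l → ofList l x ≡ true
∈⇒ofList {x} (here refl) rewrite ≡ᵇ-refl x = refl
∈⇒ofList {x} {y ∷ _} (there x∈) = ∨-trueʳ (x ≡ᵇ y) (∈⇒ofList x∈)

ofList⇒∈ : ∀ {x} l → ofList l x ≡ true → x ∈ l
ofList⇒∈ {x} (y ∷ l) p with x ≡ᵇ y in x≡ᵇy
... | true  = here (≡ᵇ-true⇒≡ x≡ᵇy)
... | false = there (ofList⇒∈ l p)

∉⇒ofList : ∀ {x} l → x ∉ l → ofList l x ≡ false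
∉⇒ofList {x} l x∉ with ofList l x in p
... | true  = ⊥-elim (x∉ (ofList⇒∈ l p))
... | false = refl

ofList-filterᵇ : ∀ (p : ℕ → Bool) l x → ofList (filterᵇ p l) x ≡ (p x ∧ ofList l x)
ofList-filterᵇ p []      x = sym (∧-zeroʳ (p x))
ofList-filterᵇ p (y ∷ l) x with p y in py | x ≡ᵇ y in x≡ᵇy
... | true  | true  rewrite ≡ᵇ-true⇒≡ {x} {y} x≡ᵇy | py | ≡ᵇ-refl y = refl
... | true  | false rewrite x≡ᵇy = ofList-filterᵇ p l x
... | false | false = ofList-filterᵇ p l x
... | false | true  rewrite ≡ᵇ-true⇒≡ {x} {y} x≡ᵇy | ofList-filterᵇ p l y | py = refl

_≐[_]_ : Subset → RankSys → Subset → Set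
X ≐[ N ] Y = ∀ x → x ∈ ground N → X x ≡ Y x

_⊆[_]_ : Subset → RankSys → Subset → Set
X ⊆[ N ] Y = ∀ x → x ∈ ground N → X x ≡ true → Y x ≡ true

Disjoint : Subset → Subset → Set
Disjoint Z Z′ = ∀ x → Z x ≡ true → Z′ x ≡ false

Disjoint-sym : ∀ {Z Z′} → Disjoint Z Z′ → Disjoint Z′ Z
Disjoint-sym {Z} Z∩Z′≡∅ x Z′x with Z x in Zx
... | true  = trans (sym Z′x) (Z∩Z′≡∅ x Zx)
... | false = refl

record IsSubmodularRank (N : RankSys) : Set where
  field
    rk-cong   : ∀ X Y → X ≐[ N ] Y → rk N X ≡ rk N Y
    rk-mono   : ∀ X Y → (∀ x → X x ≡ true → Y x ≡ true) → rk N X ≤ rk N Y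
    rk-submod : ∀ X Y → rk N (X ∪ₛ Y) + rk N (X ∩ₛ Y) ≤ rk N X + rk N Y

isMatroid⇒isSubmodularRank : ∀ {N} → IsMatroid N → IsSubmodularRank N
isMatroid⇒isSubmodularRank m = record { IsMatroid m }

connOver : RankSys → Subset → Subset → ℕ
connOver N Z X = conn (contract N X) (Z ─ₛ X)

∸-sum-exact : ∀ a b c d → b ≤ a → b ≤ c → b ≤ d → d + b ≤ a + c
  → a + c ≡ ((a ∸ b) + (c ∸ b)) ∸ (d ∸ b) + (b + d)
∸-sum-exact a b c d b≤a b≤c b≤d d+b≤a+c = begin
    a + c                              ≡⟨ a+c≡ ⟩
    (a' + c') + (b + b)                ≡⟨ cong (_+ (b + b)) (sym (m∸n+n≡m d'≤a'+c')) ⟩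
    (((a' + c') ∸ d') + d') + (b + b)  ≡⟨ solve 3 (λ t d' b → (t :+ d') :+ (b :+ b) := t :+ (b :+ (d' :+ b))) refl ((a' + c') ∸ d') d' b ⟩
    ((a' + c') ∸ d') + (b + (d' + b))  ≡⟨ cong (λ u → ((a' + c') ∸ d') + (b + u)) (m∸n+n≡m b≤d) ⟩
    ((a' + c') ∸ d') + (b + d)         ∎
  where
  open ≡-Reasoning
  a' = a ∸ b
  c' = c ∸ b
  d' = d ∸ b
  a+c≡ : a + c ≡ (a' + c') + (b + b)
  a+c≡ = trans (cong₂ _+_ (sym (m∸n+n≡m b≤a)) (sym (m∸n+n≡m b≤c)))
               (solve 3 (λ a' c' b → (a' :+ b) :+ (c' :+ b) := (a' :+ c') :+ (b :+ b)) refl a' c' b)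
  d'≤a'+c' : d' ≤ a' + c'
  d'≤a'+c' = +-cancelʳ-≤ (b + b) d' (a' + c')
    (≤-trans (≤-reflexive (trans (sym (+-assoc d' b b)) (cong (_+ b) (m∸n+n≡m b≤d))))
             (≤-trans d+b≤a+c (≤-reflexive a+c≡)))

module RankProperties {N : RankSys} (isRank : IsSubmodularRank N) where
  open IsSubmodularRank isRank

  r : Subset → ℕ
  r = rk N

  rE : ℕ
  rE = rk N (E N)

  rk-ext : ∀ X Y → (∀ x → X x ≡ Y x) → r X ≡ r Y
  rk-ext X Y X≡Y = rk-cong X Y (λ x _ → X≡Y x)

  rk-mono-on-ground : ∀ X Y → X ⊆[ N ] Y → r X ≤ r Y
  rk-mono-on-ground X Y X⊆Y = begin
      r X           ≡⟨ rk-cong X (X ∩ₛ E N) (λ x x∈ → sym (and-E {W = X} x∈)) ⟩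
      r (X ∩ₛ E N)  ≤⟨ rk-mono (X ∩ₛ E N) (Y ∩ₛ E N) inE ⟩
      r (Y ∩ₛ E N)  ≡⟨ rk-cong (Y ∩ₛ E N) Y (λ x x∈ → and-E {W = Y} x∈) ⟩
      r Y           ∎
    where
    open ≤-Reasoning
    and-E : ∀ {x} {W : Subset} → x ∈ ground N → (W x ∧ E N x) ≡ W x
    and-E {x} {W} x∈ = trans (cong (W x ∧_) (∈⇒ofList x∈)) (∧-identityʳ (W x))
    inE : ∀ x → (X x ∧ E N x) ≡ true → (Y x ∧ E N x) ≡ true
    inE x p with X x in Xx | E N x in Ex
    inE x refl | true | true rewrite X⊆Y x (ofList⇒∈ (ground N) Ex) Xx = refl

  rk-submod-≐ : ∀ X Y U I → U ≐[ N ] (X ∪ₛ Y) → I ≐[ N ] (X ∩ₛ Y) → r U + r I ≤ r X + r Y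
  rk-submod-≐ X Y U I U≐ I≐ =
    ≤-trans (≤-reflexive (cong₂ _+_ (rk-cong U (X ∪ₛ Y) U≐) (rk-cong I (X ∩ₛ Y) I≐))) (rk-submod X Y)

  connOver-unfold : ∀ Z X → connOver N Z X ≡ ((r (Z ∪ₛ X) ∸ r X) + (r ((E N ─ₛ Z) ∪ₛ X) ∸ r X)) ∸ (rE ∸ r X)
  connOver-unfold Z X = cong₂ _∸_ (cong₂ (λ u v → (u ∸ r X) + (v ∸ r X)) Z-part coZ-part) (cong (_∸ r X) E-part)
    where
    E/X : Subset
    E/X = E (contract N X)
    E/X≡ : ∀ x → E/X x ≡ (not (X x) ∧ E N x)
    E/X≡ = ofList-filterᵇ (λ x → not (X x)) (ground N)
    Z-part : r ((Z ─ₛ X) ∪ₛ X) ≡ r (Z ∪ₛ X)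
    Z-part = rk-ext _ _ λ x → lemma (Z x) (X x)
      where
      lemma : ∀ z x → ((z ∧ not x) ∨ x) ≡ (z ∨ x)
      lemma true  true  = refl
      lemma true  false = refl
      lemma false true  = refl
      lemma false false = refl
    coZ-part : r ((E/X ─ₛ (Z ─ₛ X)) ∪ₛ X) ≡ r ((E N ─ₛ Z) ∪ₛ X)
    coZ-part = rk-ext _ _ λ x → trans (cong (λ u → (u ∧ not (Z x ∧ not (X x))) ∨ X x) (E/X≡ x)) (lemma (E N x) (Z x) (X x))
      where
      lemma : ∀ e z x → (((not x ∧ e) ∧ not (z ∧ not x)) ∨ x) ≡ ((e ∧ not z) ∨ x)
      lemma true  true  true  = refl
      lemma true  true  false = refl
      lemma true  false true  = refl
      lemma true  false false = refl
      lemma false z     true  = refl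
      lemma false z     false = refl
    E-part : r (E/X ∪ₛ X) ≡ rE
    E-part = rk-cong _ _ λ x x∈ → trans (cong (_∨ X x) (E/X≡ x)) (lemma (X x) (∈⇒ofList x∈))
      where
      lemma : ∀ x {e} → e ≡ true → ((not x ∧ e) ∨ x) ≡ e
      lemma true  refl = refl
      lemma false refl = refl

  -- Monotonicity and submodularity make each truncated subtraction in connOver-unfold exact.
  connOver-spec : ∀ Z X → r (Z ∪ₛ X) + r ((E N ─ₛ Z) ∪ₛ X) ≡ connOver N Z X + (r X + rE)
  connOver-spec Z X = trans
      (∸-sum-exact (r (Z ∪ₛ X)) (r X) (r ((E N ─ₛ Z) ∪ₛ X)) rE
        (rk-mono-on-ground X (Z ∪ₛ X) (λ x _ → ∨-trueʳ (Z x)))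
        (rk-mono-on-ground X ((E N ─ₛ Z) ∪ₛ X) (λ x _ → ∨-trueʳ (E N x ∧ not (Z x))))
        (rk-mono-on-ground X (E N) (λ x x∈ _ → ∈⇒ofList x∈))
        (rk-submod-≐ (Z ∪ₛ X) ((E N ─ₛ Z) ∪ₛ X) (E N) X
          (λ x x∈ → covers (Z x) (X x) (∈⇒ofList x∈)) (λ x _ → meets (Z x) (X x) (E N x))))
      (cong (_+ (r X + rE)) (sym (connOver-unfold Z X)))
    where
    covers : ∀ z x {e} → e ≡ true → e ≡ ((z ∨ x) ∨ ((e ∧ not z) ∨ x))
    covers true  x     refl = refl
    covers false true  refl = refl
    covers false false refl = refl
    meets : ∀ z x e → x ≡ ((z ∨ x) ∧ ((e ∧ not z) ∨ x))
    meets true  x     true  = refl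
    meets true  x     false = refl
    meets false true  true  = refl
    meets false true  false = refl
    meets false false e     = refl

  connOver-cong : ∀ Z X X' → X ≐[ N ] X' → connOver N Z X ≡ connOver N Z X'
  connOver-cong Z X X' X≐X' = +-cancelʳ-≡ (r X + rE) _ _ (begin
      connOver N Z X + (r X + rE)          ≡⟨ sym (connOver-spec Z X) ⟩
      r (Z ∪ₛ X) + r ((E N ─ₛ Z) ∪ₛ X)     ≡⟨ cong₂ _+_ (rk-cong _ _ (λ x x∈ → cong (Z x ∨_) (X≐X' x x∈)))
                                                      (rk-cong _ _ (λ x x∈ → cong ((E N x ∧ not (Z x)) ∨_) (X≐X' x x∈))) ⟩
      r (Z ∪ₛ X') + r ((E N ─ₛ Z) ∪ₛ X')   ≡⟨ connOver-spec Z X' ⟩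
      connOver N Z X' + (r X' + rE)        ≡⟨ cong (λ u → connOver N Z X' + (u + rE)) (sym (rk-cong X X' X≐X')) ⟩
      connOver N Z X' + (r X + rE)         ∎)
    where open ≡-Reasoning

  connOver-⊆ : ∀ Z X → Z ⊆[ N ] X → connOver N Z X ≡ 0
  connOver-⊆ Z X Z⊆X = +-cancelʳ-≡ (r X + rE) _ 0 (begin
      connOver N Z X + (r X + rE)       ≡⟨ sym (connOver-spec Z X) ⟩
      r (Z ∪ₛ X) + r ((E N ─ₛ Z) ∪ₛ X)  ≡⟨ cong₂ _+_ (rk-cong _ _ λ x x∈ → absorbs (Z x) (X x) (Z⊆X x x∈))
                                                   (rk-cong _ _ λ x x∈ → fills (Z x) (X x) (∈⇒ofList x∈) (Z⊆X x x∈)) ⟩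
      r X + rE                          ∎)
    where
    open ≡-Reasoning
    absorbs : ∀ z x → (z ≡ true → x ≡ true) → (z ∨ x) ≡ x
    absorbs true  x z⇒x = sym (z⇒x refl)
    absorbs false x _   = refl
    fills : ∀ z x {e} → e ≡ true → (z ≡ true → x ≡ true) → ((e ∧ not z) ∨ x) ≡ e
    fills true  x refl z⇒x = z⇒x refl
    fills false x refl _   = refl

  -- Two submodularity steps through W = (Z ∩ Y) ∪ X.
  connOver-antitone : ∀ Z X Y → X ⊆[ N ] Y → connOver N Z Y ≤ connOver N Z X
  connOver-antitone Z X Y X⊆Y = +-cancelʳ-≤ ((r Y + rE) + (r X + r W)) _ _ (begin
      κY + ((r Y + rE) + (r X + r W))          ≡⟨ sym (+-assoc κY _ _) ⟩
      (κY + (r Y + rE)) + (r X + r W)          ≡⟨ cong (_+ (r X + r W)) (sym (connOver-spec Z Y)) ⟩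
      (aY + cY) + (r X + r W)                  ≡⟨ solve 4 (λ aY cY rX rT → (aY :+ cY) :+ (rX :+ rT) := (aY :+ rT) :+ (cY :+ rX)) refl aY cY (r X) (r W) ⟩
      (aY + r W) + (cY + r X)                  ≤⟨ +-mono-≤ step₁ step₂ ⟩
      (aX + r Y) + (r W + cX)                  ≡⟨ solve 4 (λ aX rY rT cX → (aX :+ rY) :+ (rT :+ cX) := (aX :+ cX) :+ (rY :+ rT)) refl aX (r Y) (r W) cX ⟩
      (aX + cX) + (r Y + r W)                  ≡⟨ cong (_+ (r Y + r W)) (connOver-spec Z X) ⟩
      (κX + (r X + rE)) + (r Y + r W)          ≡⟨ solve 5 (λ κ rX R rY rT → (κ :+ (rX :+ R)) :+ (rY :+ rT) := κ :+ ((rY :+ R) :+ (rX :+ rT))) refl κX (r X) rE (r Y) (r W) ⟩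
      κX + ((r Y + rE) + (r X + r W))          ∎)
    where
    open ≤-Reasoning
    κX = connOver N Z X
    κY = connOver N Z Y
    aX = r (Z ∪ₛ X)
    aY = r (Z ∪ₛ Y)
    cX = r ((E N ─ₛ Z) ∪ₛ X)
    cY = r ((E N ─ₛ Z) ∪ₛ Y)
    W : Subset
    W = (Z ∩ₛ Y) ∪ₛ X
    step₁ : aY + r W ≤ aX + r Y
    step₁ = rk-submod-≐ (Z ∪ₛ X) Y (Z ∪ₛ Y) W
      (λ x x∈ → ∪-eq (Z x) (X x) (Y x) (X⊆Y x x∈)) (λ x x∈ → ∩-eq (Z x) (X x) (Y x) (X⊆Y x x∈))
      where
      ∪-eq : ∀ z x y → (x ≡ true → y ≡ true) → (z ∨ y) ≡ ((z ∨ x) ∨ y)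
      ∪-eq true  x     y _   = refl
      ∪-eq false true  y x⇒y rewrite x⇒y refl = refl
      ∪-eq false false y _   = refl
      ∩-eq : ∀ z x y → (x ≡ true → y ≡ true) → ((z ∧ y) ∨ x) ≡ ((z ∨ x) ∧ y)
      ∩-eq true  true  y     x⇒y rewrite x⇒y refl = refl
      ∩-eq false true  y     x⇒y rewrite x⇒y refl = refl
      ∩-eq true  false true  _   = refl
      ∩-eq true  false false _   = refl
      ∩-eq false false y     _   = refl
    step₂ : cY + r X ≤ r W + cX
    step₂ = rk-submod-≐ W ((E N ─ₛ Z) ∪ₛ X) ((E N ─ₛ Z) ∪ₛ Y) X
      (λ x x∈ → ∪-eq (Z x) (X x) (Y x) (∈⇒ofList x∈) (X⊆Y x x∈)) (λ x _ → ∩-eq (Z x) (X x) (Y x) (E N x))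
      where
      ∪-eq : ∀ z x y {e} → e ≡ true → (x ≡ true → y ≡ true) → ((e ∧ not z) ∨ y) ≡ (((z ∧ y) ∨ x) ∨ ((e ∧ not z) ∨ x))
      ∪-eq true  true  y     refl x⇒y rewrite x⇒y refl = refl
      ∪-eq true  false true  refl _   = refl
      ∪-eq true  false false refl _   = refl
      ∪-eq false true  y     refl _   = refl
      ∪-eq false false y     refl _   = refl
      ∩-eq : ∀ z x y e → x ≡ ((z ∧ y) ∨ x) ∧ ((e ∧ not z) ∨ x)
      ∩-eq false false y     e     = refl
      ∩-eq false true  y     true  = refl
      ∩-eq false true  y     false = refl
      ∩-eq true  x     true  true  = refl
      ∩-eq true  x     true  false = refl
      ∩-eq true  true  false true  = refl
      ∩-eq true  false false true  = refl
      ∩-eq true  true  false false = refl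
      ∩-eq true  false false false = refl

  connOver-mono-rank-preserving : ∀ Z X Y → X ⊆[ N ] Y → r Y ≤ r X → connOver N Z X ≤ connOver N Z Y
  connOver-mono-rank-preserving Z X Y X⊆Y rY≤rX = +-cancelʳ-≤ (r X + rE) _ _ (begin
      connOver N Z X + (r X + rE)         ≡⟨ sym (connOver-spec Z X) ⟩
      r (Z ∪ₛ X) + r ((E N ─ₛ Z) ∪ₛ X)    ≤⟨ +-mono-≤ (rk-mono-on-ground _ _ λ x x∈ → ∪-mono (Z x) (X⊆Y x x∈))
                                                    (rk-mono-on-ground _ _ λ x x∈ → ∪-mono (E N x ∧ not (Z x)) (X⊆Y x x∈)) ⟩
      r (Z ∪ₛ Y) + r ((E N ─ₛ Z) ∪ₛ Y)    ≡⟨ connOver-spec Z Y ⟩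
      connOver N Z Y + (r Y + rE)         ≤⟨ +-monoʳ-≤ (connOver N Z Y) (+-monoˡ-≤ rE rY≤rX) ⟩
      connOver N Z Y + (r X + rE)         ∎)
    where
    open ≤-Reasoning
    ∪-mono : ∀ z {x y} → (x ≡ true → y ≡ true) → (z ∨ x) ≡ true → (z ∨ y) ≡ true
    ∪-mono true  _   _ = refl
    ∪-mono false x⇒y p = x⇒y p

  -- By connOver-spec, connOver N Z X + (r X + rE) is r(Z ∪ X) + r((E − Z) ∪ X),
  -- a sum of two submodular functions of X.
  connOver-submodular : ∀ Z X Y →
    (connOver N Z (X ∩ₛ Y) + (r (X ∩ₛ Y) + rE)) + (connOver N Z (X ∪ₛ Y) + (r (X ∪ₛ Y) + rE))
      ≤ (connOver N Z X + (r X + rE)) + (connOver N Z Y + (r Y + rE))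
  connOver-submodular Z X Y = begin
      (connOver N Z (X ∩ₛ Y) + (r (X ∩ₛ Y) + rE)) + (connOver N Z (X ∪ₛ Y) + (r (X ∪ₛ Y) + rE))
        ≡⟨ sym (cong₂ _+_ (connOver-spec Z (X ∩ₛ Y)) (connOver-spec Z (X ∪ₛ Y))) ⟩
      (aI + cI) + (aU + cU)  ≡⟨ solve 4 (λ aI cI aU cU → (aI :+ cI) :+ (aU :+ cU) := (aU :+ aI) :+ (cU :+ cI)) refl aI cI aU cU ⟩
      (aU + aI) + (cU + cI)  ≤⟨ +-mono-≤ (submod-over Z) (submod-over (E N ─ₛ Z)) ⟩
      (aX + aY) + (cX + cY)  ≡⟨ solve 4 (λ aX aY cX cY → (aX :+ aY) :+ (cX :+ cY) := (aX :+ cX) :+ (aY :+ cY)) refl aX aY cX cY ⟩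
      (aX + cX) + (aY + cY)  ≡⟨ cong₂ _+_ (connOver-spec Z X) (connOver-spec Z Y) ⟩
      (connOver N Z X + (r X + rE)) + (connOver N Z Y + (r Y + rE)) ∎
    where
    open ≤-Reasoning
    submod-over : ∀ W → r (W ∪ₛ (X ∪ₛ Y)) + r (W ∪ₛ (X ∩ₛ Y)) ≤ r (W ∪ₛ X) + r (W ∪ₛ Y)
    submod-over W = rk-submod-≐ (W ∪ₛ X) (W ∪ₛ Y) _ _ (λ x _ → ∪-eq (W x)) (λ x _ → ∩-eq (W x))
      where
      ∪-eq : ∀ w {x y} → (w ∨ (x ∨ y)) ≡ ((w ∨ x) ∨ (w ∨ y))
      ∪-eq true  = refl
      ∪-eq false = refl
      ∩-eq : ∀ w {x y} → (w ∨ (x ∧ y)) ≡ ((w ∨ x) ∧ (w ∨ y))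
      ∩-eq true  = refl
      ∩-eq false = refl
    aI = r (Z ∪ₛ (X ∩ₛ Y))
    cI = r ((E N ─ₛ Z) ∪ₛ (X ∩ₛ Y))
    aU = r (Z ∪ₛ (X ∪ₛ Y))
    cU = r ((E N ─ₛ Z) ∪ₛ (X ∪ₛ Y))
    aX = r (Z ∪ₛ X)
    cX = r ((E N ─ₛ Z) ∪ₛ X)
    aY = r (Z ∪ₛ Y)
    cY = r ((E N ─ₛ Z) ∪ₛ Y)

  -- Both sides equal r(Z ∪ Z′ ∪ X) + r((E − Z) ∪ X) + r((E − Z′) ∪ X) − r X − 2 rE;
  -- disjointness is what makes (E − Z) ∪ Z′ ∪ X equal to (E − Z) ∪ X.
  connOver-exchange : ∀ Z Z′ X → Disjoint Z Z′ →
    connOver N Z X + connOver N Z′ (Z ∪ₛ X) ≡ connOver N Z′ X + connOver N Z (Z′ ∪ₛ X)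
  connOver-exchange Z Z′ X Z∩Z′≡∅ = +-cancelʳ-≡ W _ _ (begin
      (p + t) + W                                            ≡⟨ solve 6 (λ p t rX R aZ aZ′ → (p :+ t) :+ ((((rX :+ R) :+ R) :+ aZ) :+ aZ′) := ((p :+ (rX :+ R)) :+ (t :+ (aZ :+ R))) :+ aZ′) refl p t (r X) rE aZ aZ′ ⟩
      ((p + (r X + rE)) + (t + (aZ + rE))) + aZ′             ≡⟨ cong₂ (λ u v → (u + v) + aZ′) (sym (connOver-spec Z X)) (sym spec-t) ⟩
      ((aZ + cZ) + (U + cZ′)) + aZ′                          ≡⟨ solve 5 (λ aZ cZ U cZ′ aZ′ → ((aZ :+ cZ) :+ (U :+ cZ′)) :+ aZ′ := ((aZ′ :+ cZ′) :+ (U :+ cZ)) :+ aZ) refl aZ cZ U cZ′ aZ′ ⟩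
      ((aZ′ + cZ′) + (U + cZ)) + aZ                          ≡⟨ cong₂ (λ u v → (u + v) + aZ) (connOver-spec Z′ X) spec-s ⟩
      ((q + (r X + rE)) + (s + (aZ′ + rE))) + aZ             ≡⟨ solve 6 (λ q s rX R aZ aZ′ → ((q :+ (rX :+ R)) :+ (s :+ (aZ′ :+ R))) :+ aZ := (q :+ s) :+ ((((rX :+ R) :+ R) :+ aZ) :+ aZ′)) refl q s (r X) rE aZ aZ′ ⟩
      (q + s) + W                                            ∎)
    where
    open ≡-Reasoning
    p = connOver N Z X
    q = connOver N Z′ X
    s = connOver N Z (Z′ ∪ₛ X)
    t = connOver N Z′ (Z ∪ₛ X)
    aZ = r (Z ∪ₛ X)
    aZ′ = r (Z′ ∪ₛ X)
    cZ = r ((E N ─ₛ Z) ∪ₛ X)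
    cZ′ = r ((E N ─ₛ Z′) ∪ₛ X)
    U = r (Z ∪ₛ (Z′ ∪ₛ X))
    W = (((r X + rE) + rE) + aZ) + aZ′
    absorb : ∀ z z′ x {e} → e ≡ true → (z′ ≡ true → z ≡ false) → ((e ∧ not z) ∨ (z′ ∨ x)) ≡ ((e ∧ not z) ∨ x)
    absorb true  true  x refl z′⇒¬z with () ← z′⇒¬z refl
    absorb true  false x refl _ = refl
    absorb false z′    x refl _ = refl
    spec-s : U + cZ ≡ s + (aZ′ + rE)
    spec-s = trans (cong (U +_) (rk-cong _ _ λ x x∈ → sym (absorb (Z x) (Z′ x) (X x) (∈⇒ofList x∈) (Disjoint-sym Z∩Z′≡∅ x))))
                   (connOver-spec Z (Z′ ∪ₛ X))
    spec-t : U + cZ′ ≡ t + (aZ + rE)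
    spec-t = trans (cong₂ _+_ (rk-ext _ _ λ x → ∨-left-comm (Z x) (Z′ x) (X x))
                              (rk-cong _ _ λ x x∈ → sym (absorb (Z′ x) (Z x) (X x) (∈⇒ofList x∈) (Z∩Z′≡∅ x))))
                   (connOver-spec Z′ (Z ∪ₛ X))

sgn : ℕ → ℕ
sgn zero    = 0
sgn (suc _) = 1

sgn≤1 : ∀ k → sgn k ≤ 1
sgn≤1 zero    = z≤n
sgn≤1 (suc _) = s≤s z≤n

sgn≤id : ∀ k → sgn k ≤ k
sgn≤id zero    = z≤n
sgn≤id (suc _) = s≤s z≤n

sgn-mono : ∀ {j k} → j ≤ k → sgn j ≤ sgn k
sgn-mono {zero}          _ = z≤n
sgn-mono {suc _} {suc _} _ = s≤s z≤n

contribution : Bool → ℕ → ℕ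
contribution true  k = sgn k
contribution false _ = 0

rk-freeAdd : ∀ N Z e A →
  rk (freeAdd N Z e) A ≡ rk N (A ∩ₛ E N) + contribution (A e) (connOver N Z (A ∩ₛ E N))
rk-freeAdd N Z e A = unfold (A e) (connOver N Z (A ∩ₛ E N)) (rk N (A ∩ₛ E N))
  where
  unfold : ∀ b k r → (if b then (if k ≡ᵇ 0 then r else suc r) else r) ≡ r + contribution b k
  unfold true  zero    r = sym (+-identityʳ r)
  unfold true  (suc _) r = sym (+-comm r 1)
  unfold false _       r = sym (+-identityʳ r)

+-sgn-mono : ∀ r r' k k' → r ≤ r' → (r' ≤ r → k ≤ k') → r + sgn k ≤ r' + sgn k'
+-sgn-mono r r' k k' r≤r' k≤k' with r' ≤? r
... | yes r'≤r = +-mono-≤ r≤r' (sgn-mono (k≤k' r'≤r))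
... | no  r'≰r = begin
    r + sgn k  ≤⟨ +-monoʳ-≤ r (sgn≤1 k) ⟩
    r + 1      ≡⟨ +-comm r 1 ⟩
    suc r      ≤⟨ ≰⇒> r'≰r ⟩
    r'         ≤⟨ m≤m+n r' _ ⟩
    r' + sgn k' ∎
  where open ≤-Reasoning

-- The only tight case is a = b = true with kX = kY = 0: then kU = 0, and the
-- second hypothesis pays for sgn kI ≤ kI.
+-contribution-submod : ∀ a b {rU rI rX rY kU kI kX kY R} → rU + rI ≤ rX + rY
  → (kI + (rI + R)) + (kU + (rU + R)) ≤ (kX + (rX + R)) + (kY + (rY + R))
  → kU ≤ kX → kU ≤ kY
  → (rU + contribution (a ∨ b) kU) + (rI + contribution (a ∧ b) kI)
      ≤ (rX + contribution a kX) + (rY + contribution b kY)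
+-contribution-submod a b {rU} {rI} {rX} {rY} {kU} {kI} {kX} {kY} {R} r-submod k-submod kU≤kX kU≤kY =
  ≤-trans (≤-reflexive (shuffle rU _ rI _)) (≤-trans (cases a b kX kY kU≤kX kU≤kY k-submod) (≤-reflexive (sym (shuffle rX _ rY _))))
  where
  shuffle : ∀ a x b y → (a + x) + (b + y) ≡ (a + b) + (x + y)
  shuffle = solve 4 (λ a x b y → (a :+ x) :+ (b :+ y) := (a :+ b) :+ (x :+ y)) refl
  cases : ∀ a b kX kY → kU ≤ kX → kU ≤ kY → (kI + (rI + R)) + (kU + (rU + R)) ≤ (kX + (rX + R)) + (kY + (rY + R))
    → (rU + rI) + (contribution (a ∨ b) kU + contribution (a ∧ b) kI) ≤ (rX + rY) + (contribution a kX + contribution b kY)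
  cases false false _       _       _     _     _ = +-mono-≤ r-submod z≤n
  cases true  false _       _       kU≤kX _     _ = +-mono-≤ r-submod (+-monoˡ-≤ 0 (sgn-mono kU≤kX))
  cases false true  _       _       _     kU≤kY _ = +-mono-≤ r-submod (≤-trans (≤-reflexive (+-identityʳ (sgn kU))) (sgn-mono kU≤kY))
  cases true  true  (suc _) (suc _) _     _     _ = +-mono-≤ r-submod (+-mono-≤ (sgn≤1 kU) (sgn≤1 kI))
  cases true  true  (suc _) zero    _     z≤n   _ = +-mono-≤ r-submod (sgn≤1 kI)
  cases true  true  zero    (suc _) z≤n   _     _ = +-mono-≤ r-submod (sgn≤1 kI)
  cases true  true  zero    zero    z≤n   _     k-submod′ = +-cancelʳ-≤ (R + R) _ _ (begin
      ((rU + rI) + (0 + sgn kI)) + (R + R)  ≤⟨ +-monoˡ-≤ (R + R) (+-monoʳ-≤ (rU + rI) (sgn≤id kI)) ⟩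
      ((rU + rI) + (0 + kI)) + (R + R)      ≡⟨ solve 4 (λ rU rI kI R → ((rU :+ rI) :+ kI) :+ (R :+ R) := (kI :+ (rI :+ R)) :+ (rU :+ R)) refl rU rI kI R ⟩
      (kI + (rI + R)) + (0 + (rU + R))      ≤⟨ k-submod′ ⟩
      (0 + (rX + R)) + (0 + (rY + R))       ≡⟨ solve 3 (λ rX rY R → (rX :+ R) :+ (rY :+ R) := ((rX :+ rY) :+ con 0) :+ (R :+ R)) refl rX rY R ⟩
      ((rX + rY) + 0) + (R + R)             ∎)
    where open ≤-Reasoning

module _ {N : RankSys} (isRank : IsSubmodularRank N) (Z : Subset) (e : ℕ) where
  open IsSubmodularRank isRank
  open RankProperties isRank

  private
    N′ : RankSys
    N′ = freeAdd N Z e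
    κ : Subset → ℕ
    κ X = connOver N Z X
    _∩E : Subset → Subset
    A ∩E = A ∩ₛ E N

  freeAdd-rk-cong : ∀ A A′ → A ≐[ N′ ] A′ → rk N′ A ≡ rk N′ A′
  freeAdd-rk-cong A A′ A≐A′ = begin
      rk N′ A                                   ≡⟨ rk-freeAdd N Z e A ⟩
      r (A ∩E) + contribution (A e) (κ (A ∩E))  ≡⟨ cong₂ _+_ (rk-cong _ _ ∩E-≐) (cong₂ contribution (A≐A′ e (here refl)) (connOver-cong Z _ _ ∩E-≐)) ⟩
      r (A′ ∩E) + contribution (A′ e) (κ (A′ ∩E)) ≡⟨ sym (rk-freeAdd N Z e A′) ⟩
      rk N′ A′                                  ∎
    where
    open ≡-Reasoning
    ∩E-≐ : (A ∩E) ≐[ N ] (A′ ∩E)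
    ∩E-≐ x x∈ = cong (_∧ E N x) (A≐A′ x (there x∈))

  freeAdd-rk-mono : ∀ A A′ → (∀ x → A x ≡ true → A′ x ≡ true) → rk N′ A ≤ rk N′ A′
  freeAdd-rk-mono A A′ A⊆A′ = begin
      rk N′ A                                     ≡⟨ rk-freeAdd N Z e A ⟩
      r (A ∩E) + contribution (A e) (κ (A ∩E))    ≤⟨ by-e (A e) (A′ e) (A⊆A′ e) ⟩
      r (A′ ∩E) + contribution (A′ e) (κ (A′ ∩E)) ≡⟨ sym (rk-freeAdd N Z e A′) ⟩
      rk N′ A′                                    ∎
    where
    open ≤-Reasoning
    ∩E-⊆ : ∀ x → (A x ∧ E N x) ≡ true → (A′ x ∧ E N x) ≡ true
    ∩E-⊆ x p with A x in Ax
    ∩E-⊆ x p | true rewrite A⊆A′ x Ax = p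
    r-mono : r (A ∩E) ≤ r (A′ ∩E)
    r-mono = rk-mono _ _ ∩E-⊆
    by-e : ∀ b b′ → (b ≡ true → b′ ≡ true)
         → r (A ∩E) + contribution b (κ (A ∩E)) ≤ r (A′ ∩E) + contribution b′ (κ (A′ ∩E))
    by-e false _  _    = ≤-trans (≤-reflexive (+-identityʳ _)) (≤-trans r-mono (m≤m+n _ _))
    by-e true  b′ b⇒b′ rewrite b⇒b′ refl =
      +-sgn-mono _ _ _ _ r-mono (connOver-mono-rank-preserving Z (A ∩E) (A′ ∩E) (λ x _ → ∩E-⊆ x))

  freeAdd-rk-submod : ∀ A B → rk N′ (A ∪ₛ B) + rk N′ (A ∩ₛ B) ≤ rk N′ A + rk N′ B
  freeAdd-rk-submod A B = begin
      rk N′ (A ∪ₛ B) + rk N′ (A ∩ₛ B)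
        ≡⟨ cong₂ _+_ (trans (rk-freeAdd N Z e (A ∪ₛ B)) (cong₂ _+_ (rk-ext _ _ ∪-∩E) (cong (contribution (A e ∨ B e)) (connOver-cong Z _ _ λ x _ → ∪-∩E x))))
                     (trans (rk-freeAdd N Z e (A ∩ₛ B)) (cong₂ _+_ (rk-ext _ _ ∩-∩E) (cong (contribution (A e ∧ B e)) (connOver-cong Z _ _ λ x _ → ∩-∩E x)))) ⟩
      (r (XA ∪ₛ XB) + contribution (A e ∨ B e) (κ (XA ∪ₛ XB))) + (r (XA ∩ₛ XB) + contribution (A e ∧ B e) (κ (XA ∩ₛ XB)))
        ≤⟨ +-contribution-submod (A e) (B e) {rI = r (XA ∩ₛ XB)} {rX = r XA} {rY = r XB} {kI = κ (XA ∩ₛ XB)} {R = rE}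
             (rk-submod XA XB) (connOver-submodular Z XA XB)
             (connOver-antitone Z XA (XA ∪ₛ XB) (λ x _ p → cong (_∨ XB x) p)) (connOver-antitone Z XB (XA ∪ₛ XB) (λ x _ p → ∨-trueʳ (XA x) p)) ⟩
      (r XA + contribution (A e) (κ XA)) + (r XB + contribution (B e) (κ XB))
        ≡⟨ sym (cong₂ _+_ (rk-freeAdd N Z e A) (rk-freeAdd N Z e B)) ⟩
      rk N′ A + rk N′ B ∎
    where
    open ≤-Reasoning
    XA = A ∩E
    XB = B ∩E
    ∪-∩E : ∀ x → ((A x ∨ B x) ∧ E N x) ≡ (XA x ∨ XB x)
    ∪-∩E x = ∧-distribʳ-∨ (E N x) (A x) (B x)
    ∩-∩E : ∀ x → ((A x ∧ B x) ∧ E N x) ≡ (XA x ∧ XB x)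
    ∩-∩E x = lemma (A x) (B x) (E N x)
      where
      lemma : ∀ a b c → ((a ∧ b) ∧ c) ≡ ((a ∧ c) ∧ (b ∧ c))
      lemma true  true  true  = refl
      lemma true  true  false = refl
      lemma true  false true  = refl
      lemma true  false false = refl
      lemma false b     c     = refl

freeAdd-isSubmodularRank : ∀ {N} Z e → IsSubmodularRank N → IsSubmodularRank (freeAdd N Z e)
freeAdd-isSubmodularRank Z e isRank = record
  { rk-cong = freeAdd-rk-cong isRank Z e ; rk-mono = freeAdd-rk-mono isRank Z e ; rk-submod = freeAdd-rk-submod isRank Z e }

module _ {N : RankSys} (isRank : IsSubmodularRank N) (Z : Subset) (e : ℕ) where
  open IsSubmodularRank isRank
  open RankProperties isRank

  private
    N′ : RankSys
    N′ = freeAdd N Z e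

  E-freeAdd-≐ : E N′ ≐[ N ] E N
  E-freeAdd-≐ x x∈ = trans (∈⇒ofList (there x∈)) (sym (∈⇒ofList x∈))

  rk-freeAdd-≐ : ∀ W V → W ≐[ N ] V → rk N′ W ≡ r V + contribution (W e) (connOver N Z V)
  rk-freeAdd-≐ W V W≐V =
    trans (rk-freeAdd N Z e W) (cong₂ _+_ (rk-cong _ _ W∩E≐V) (cong (contribution (W e)) (connOver-cong Z _ _ W∩E≐V)))
    where
    W∩E≐V : (W ∩ₛ E N) ≐[ N ] V
    W∩E≐V x x∈ = trans (cong (W x ∧_) (∈⇒ofList x∈)) (trans (∧-identityʳ (W x)) (W≐V x x∈))

  e∈-∩E-freeAdd : ∀ A → (A ∩ₛ E N′) e ≡ A e
  e∈-∩E-freeAdd A = trans (cong (λ b → A e ∧ (b ∨ E N e)) (≡ᵇ-refl e)) (∧-identityʳ (A e))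

  rk-freeAdd-∩E : ∀ A → rk N′ (A ∩ₛ E N′) ≡ r (A ∩ₛ E N) + contribution (A e) (connOver N Z (A ∩ₛ E N))
  rk-freeAdd-∩E A =
    trans (rk-freeAdd-≐ (A ∩ₛ E N′) (A ∩ₛ E N) λ x x∈ → cong (A x ∧_) (E-freeAdd-≐ x x∈))
          (cong (λ b → r (A ∩ₛ E N) + contribution b (connOver N Z (A ∩ₛ E N))) (e∈-∩E-freeAdd A))

  -- Expand connOver-spec for Z′ over A ∩ E(N′) in N′ by rk-freeAdd: on Z′ ∪ X the
  -- element e contributes through connOver N Z (Z′ ∪ X), while (E − Z′) ∪ X
  -- contains Z, so there e contributes nothing.
  connOver-freeAdd : ∀ Z′ A → Z′ e ≡ false → Disjoint Z Z′ →
    connOver N Z′ (A ∩ₛ E N) + contribution (A e) (connOver N Z (Z′ ∪ₛ (A ∩ₛ E N)))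
      ≡ contribution (A e) (connOver N Z (A ∩ₛ E N)) + connOver N′ Z′ (A ∩ₛ E N′)
  connOver-freeAdd Z′ A Z′e Z∩Z′≡∅ = +-cancelʳ-≡ (r X + rE) _ _ (begin
      (q + s) + (r X + rE)                           ≡⟨ solve 3 (λ q s m → (q :+ s) :+ m := (q :+ m) :+ s) refl q s (r X + rE) ⟩
      (q + (r X + rE)) + s                           ≡⟨ cong (_+ s) (sym (connOver-spec Z′ X)) ⟩
      (r (Z′ ∪ₛ X) + r ((E N ─ₛ Z′) ∪ₛ X)) + s       ≡⟨ solve 3 (λ a c s → (a :+ c) :+ s := (a :+ s) :+ c) refl (r (Z′ ∪ₛ X)) (r ((E N ─ₛ Z′) ∪ₛ X)) s ⟩
      (r (Z′ ∪ₛ X) + s) + r ((E N ─ₛ Z′) ∪ₛ X)       ≡⟨ sym (cong₂ _+_ rk-Z′∪X′ rk-coZ′∪X′) ⟩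
      rk N′ (Z′ ∪ₛ X′) + rk N′ ((E N′ ─ₛ Z′) ∪ₛ X′)  ≡⟨ RankProperties.connOver-spec (freeAdd-isSubmodularRank Z e isRank) Z′ X′ ⟩
      κ′ + (rk N′ X′ + rk N′ (E N′))                 ≡⟨ cong₂ (λ u v → κ′ + (u + v)) (rk-freeAdd-∩E A) rk-E′ ⟩
      κ′ + ((r X + p) + rE)                          ≡⟨ solve 4 (λ κ′ rX p R → κ′ :+ ((rX :+ p) :+ R) := (p :+ κ′) :+ (rX :+ R)) refl κ′ (r X) p rE ⟩
      (p + κ′) + (r X + rE)                          ∎)
    where
    open ≡-Reasoning
    X = A ∩ₛ E N
    X′ = A ∩ₛ E N′
    p = contribution (A e) (connOver N Z X)
    q = connOver N Z′ X
    s = contribution (A e) (connOver N Z (Z′ ∪ₛ X))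
    κ′ = connOver N′ Z′ X′
    contribution-0 : ∀ b {k} → k ≡ 0 → contribution b k ≡ 0
    contribution-0 true  refl = refl
    contribution-0 false _    = refl
    rk-Z′∪X′ : rk N′ (Z′ ∪ₛ X′) ≡ r (Z′ ∪ₛ X) + s
    rk-Z′∪X′ = trans (rk-freeAdd-≐ (Z′ ∪ₛ X′) (Z′ ∪ₛ X) (λ x x∈ → cong (λ b → Z′ x ∨ (A x ∧ b)) (E-freeAdd-≐ x x∈)))
                     (cong (λ b → r (Z′ ∪ₛ X) + contribution b (connOver N Z (Z′ ∪ₛ X))) (cong₂ _∨_ Z′e (e∈-∩E-freeAdd A)))
    rk-coZ′∪X′ : rk N′ ((E N′ ─ₛ Z′) ∪ₛ X′) ≡ r ((E N ─ₛ Z′) ∪ₛ X)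
    rk-coZ′∪X′ = trans (rk-freeAdd-≐ _ ((E N ─ₛ Z′) ∪ₛ X)
                          (λ x x∈ → cong₂ (λ u v → (u ∧ not (Z′ x)) ∨ (A x ∧ v)) (E-freeAdd-≐ x x∈) (E-freeAdd-≐ x x∈)))
                       (trans (cong (r ((E N ─ₛ Z′) ∪ₛ X) +_) (contribution-0 ((E N′ e ∧ not (Z′ e)) ∨ X′ e) (connOver-⊆ Z _ Z⊆coZ′)))
                              (+-identityʳ _))
      where
      Z⊆coZ′ : Z ⊆[ N ] ((E N ─ₛ Z′) ∪ₛ X)
      Z⊆coZ′ x x∈ Zx rewrite Z∩Z′≡∅ x Zx | ∈⇒ofList x∈ = refl
    rk-E′ : rk N′ (E N′) ≡ rE
    rk-E′ = trans (rk-freeAdd-≐ (E N′) (E N) E-freeAdd-≐)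
                  (trans (cong (rE +_) (contribution-0 (E N′ e) (connOver-⊆ Z (E N) λ x x∈ _ → ∈⇒ofList x∈))) (+-identityʳ rE))

sgn-+-sgn : ∀ a b → sgn (a + sgn b) ≡ sgn (a + b)
sgn-+-sgn (suc a) b       = refl
sgn-+-sgn zero    zero    = refl
sgn-+-sgn zero    (suc b) = refl

sgn-exchange : ∀ p q s t k₁ k₂ → p + t ≡ q + s → q + sgn s ≡ sgn p + k₁ → p + sgn t ≡ sgn q + k₂
  → sgn p + sgn k₁ ≡ sgn q + sgn k₂
sgn-exchange zero    zero    _ _ _ _ refl refl refl = refl
sgn-exchange zero    (suc _) _ _ _ _ refl refl refl = refl
sgn-exchange (suc _) zero    _ _ _ _ refl refl refl = refl
sgn-exchange (suc p) (suc q) s t _ _ p+t≡q+s refl refl =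
  cong suc (trans (sgn-+-sgn q s) (trans (cong sgn (sym (suc-injective p+t≡q+s))) (sym (sgn-+-sgn p t))))

contribution-exchange : ∀ a b p q s t k₁ k₂ → p + t ≡ q + s
  → q + contribution a s ≡ contribution a p + k₁ → p + contribution b t ≡ contribution b q + k₂
  → contribution a p + contribution b k₁ ≡ contribution b q + contribution a k₂
contribution-exchange false false _ _ _ _ _  _  _ _  _  = refl
contribution-exchange false true  _ q _ _ k₁ _  _ q≡k₁ _ =
  trans (cong sgn (trans (sym q≡k₁) (+-identityʳ q))) (sym (+-identityʳ (sgn q)))
contribution-exchange true  false p _ _ _ _  k₂ _ _ p≡k₂ =
  trans (+-identityʳ (sgn p)) (cong sgn (trans (sym (+-identityʳ p)) p≡k₂))
contribution-exchange true  true  p q s t k₁ k₂ = sgn-exchange p q s t k₁ k₂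

rk-freeAdd-freeAdd : ∀ {N} → IsSubmodularRank N → ∀ Z Z′ e f A →
  rk (freeAdd (freeAdd N Z e) Z′ f) A
    ≡ rk N (A ∩ₛ E N) + (contribution (A e) (connOver N Z (A ∩ₛ E N))
                          + contribution (A f) (connOver (freeAdd N Z e) Z′ (A ∩ₛ E (freeAdd N Z e))))
rk-freeAdd-freeAdd {N} isRank Z Z′ e f A =
  trans (rk-freeAdd (freeAdd N Z e) Z′ f A)
        (trans (cong (_+ contribution (A f) (connOver (freeAdd N Z e) Z′ (A ∩ₛ E (freeAdd N Z e)))) (rk-freeAdd-∩E isRank Z e A))
               (+-assoc (rk N (A ∩ₛ E N)) _ _))

-- By rk-freeAdd-freeAdd both ranks are r(X) plus the contributions of e and f;
-- connOver-freeAdd expresses each second contribution through connectivities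
-- of N, which connOver-exchange relates.
rk-freeAdd-comm : ∀ {N} → IsSubmodularRank N → ∀ Z Z′ e f → Disjoint Z Z′
  → Z f ≡ false → Z′ e ≡ false
  → ∀ A → rk (freeAdd (freeAdd N Z e) Z′ f) A ≡ rk (freeAdd (freeAdd N Z′ f) Z e) A
rk-freeAdd-comm {N} isRank Z Z′ e f Z∩Z′≡∅ Zf Z′e A = begin
    rk (freeAdd (freeAdd N Z e) Z′ f) A  ≡⟨ rk-freeAdd-freeAdd isRank Z Z′ e f A ⟩
    r X + (contribution (A e) p + contribution (A f) _)
      ≡⟨ cong (r X +_) (contribution-exchange (A e) (A f) p q s t _ _
                          (RankProperties.connOver-exchange isRank Z Z′ X Z∩Z′≡∅)
                          (connOver-freeAdd isRank Z e Z′ A Z′e Z∩Z′≡∅)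
                          (connOver-freeAdd isRank Z′ f Z A Zf (Disjoint-sym Z∩Z′≡∅))) ⟩
    r X + (contribution (A f) q + contribution (A e) _)  ≡⟨ sym (rk-freeAdd-freeAdd isRank Z′ Z f e A) ⟩
    rk (freeAdd (freeAdd N Z′ f) Z e) A  ∎
  where
  open ≡-Reasoning
  open RankProperties isRank using (r)
  X = A ∩ₛ E N
  p = connOver N Z X
  q = connOver N Z′ X
  s = connOver N Z (Z′ ∪ₛ X)
  t = connOver N Z′ (Z ∪ₛ X)

record _≈_ (N N′ : RankSys) : Set where
  constructor mk≈
  field
    E-≡  : ∀ x → E N x ≡ E N′ x
    rk-≡ : ∀ X → rk N X ≡ rk N′ X
open _≈_

≈-refl : ∀ {N} → N ≈ N
≈-refl = mk≈ (λ _ → refl) (λ _ → refl)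

≈-sym : ∀ {N N′} → N ≈ N′ → N′ ≈ N
≈-sym (mk≈ E-≡ rk-≡) = mk≈ (λ x → sym (E-≡ x)) (λ X → sym (rk-≡ X))

≈-trans : ∀ {N N′ N″} → N ≈ N′ → N′ ≈ N″ → N ≈ N″
≈-trans (mk≈ E-≡ rk-≡) (mk≈ E-≡′ rk-≡′) = mk≈ (λ x → trans (E-≡ x) (E-≡′ x)) (λ X → trans (rk-≡ X) (rk-≡′ X))

≈⇒∈ : ∀ {N N′} → N ≈ N′ → ∀ {x} → x ∈ ground N → x ∈ ground N′
≈⇒∈ {N} {N′} N≈N′ {x} x∈ = ofList⇒∈ (ground N′) (trans (sym (E-≡ N≈N′ x)) (∈⇒ofList x∈))

≈⇒≅ : ∀ {N N′} → N ≈ N′ → N ≅ N′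
≈⇒≅ N≈N′ = (λ _ → mk⇔ (≈⇒∈ N≈N′) (≈⇒∈ (≈-sym N≈N′))) , (λ X _ → rk-≡ N≈N′ X)

connOver-≈ : ∀ {N N′} → N ≈ N′ → IsSubmodularRank N′ → ∀ Z X → connOver N Z X ≡ connOver N′ Z X
connOver-≈ {N} {N′} (mk≈ E-≡ rk-≡) isRank′ Z X =
  cong₂ _∸_ (cong₂ _+_ (cong₂ _∸_ (rk-≡ _) (rk-≡ X)) (cong₂ _∸_ (transport λ x → cong (λ u → (u ∧ not (Z x ∧ not (X x))) ∨ X x) (E/X-≡ x)) (rk-≡ X)))
            (cong₂ _∸_ (transport λ x → cong (_∨ X x) (E/X-≡ x)) (rk-≡ X))
  where
  transport : ∀ {W W′} → (∀ x → W x ≡ W′ x) → rk N W ≡ rk N′ W′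
  transport {W} {W′} W≡W′ = trans (rk-≡ W) (RankProperties.rk-ext isRank′ W W′ W≡W′)
  E/X-≡ : ∀ x → E (contract N X) x ≡ E (contract N′ X) x
  E/X-≡ x = trans (ofList-filterᵇ _ (ground N) x)
                  (trans (cong (not (X x) ∧_) (E-≡ x)) (sym (ofList-filterᵇ _ (ground N′) x)))

freeAdd-cong : ∀ {N N′} → N ≈ N′ → IsSubmodularRank N′ → ∀ Z e → freeAdd N Z e ≈ freeAdd N′ Z e
freeAdd-cong {N} {N′} N≈N′ isRank′ Z e = mk≈ (λ x → cong ((x ≡ᵇ e) ∨_) (E-≡ N≈N′ x)) λ A → begin
    rk (freeAdd N Z e) A
      ≡⟨ rk-freeAdd N Z e A ⟩
    rk N (A ∩ₛ E N) + contribution (A e) (connOver N Z (A ∩ₛ E N))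
      ≡⟨ cong₂ _+_ (trans (rk-≡ N≈N′ _) (rk-ext _ _ (∩E-≡ A)))
                   (cong (contribution (A e)) (trans (connOver-≈ N≈N′ isRank′ Z _) (connOver-cong Z _ _ λ x _ → ∩E-≡ A x))) ⟩
    rk N′ (A ∩ₛ E N′) + contribution (A e) (connOver N′ Z (A ∩ₛ E N′))
      ≡⟨ sym (rk-freeAdd N′ Z e A) ⟩
    rk (freeAdd N′ Z e) A ∎
  where
  open ≡-Reasoning
  open RankProperties isRank′
  ∩E-≡ : ∀ A x → (A x ∧ E N x) ≡ (A x ∧ E N′ x)
  ∩E-≡ A x = cong (A x ∧_) (E-≡ N≈N′ x)

freeAdd-comm : ∀ {N} → IsSubmodularRank N → ∀ Z Z′ e f → Disjoint Z Z′ → Z f ≡ false → Z′ e ≡ false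
  → freeAdd (freeAdd N Z e) Z′ f ≈ freeAdd (freeAdd N Z′ f) Z e
freeAdd-comm isRank Z Z′ e f Z∩Z′≡∅ Zf Z′e =
  mk≈ (λ x → ∨-left-comm (x ≡ᵇ f) (x ≡ᵇ e) _) (rk-freeAdd-comm isRank Z Z′ e f Z∩Z′≡∅ Zf Z′e)

freeAddList-isSubmodularRank : ∀ {N} Z es → IsSubmodularRank N → IsSubmodularRank (freeAddList N Z es)
freeAddList-isSubmodularRank Z []       isRank = isRank
freeAddList-isSubmodularRank Z (e ∷ es) isRank =
  freeAddList-isSubmodularRank Z es (freeAdd-isSubmodularRank Z e isRank)

freeAddList-cong : ∀ {N N′} → N ≈ N′ → IsSubmodularRank N′ → ∀ Z es → freeAddList N Z es ≈ freeAddList N′ Z es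
freeAddList-cong N≈N′ isRank′ Z []       = N≈N′
freeAddList-cong N≈N′ isRank′ Z (e ∷ es) =
  freeAddList-cong (freeAdd-cong N≈N′ isRank′ Z e) (freeAdd-isSubmodularRank Z e isRank′) Z es

freeAdd-freeAddList-comm : ∀ {N} → IsSubmodularRank N → ∀ Z Z′ es f → Disjoint Z Z′
  → Z f ≡ false → All (λ e → Z′ e ≡ false) es
  → freeAdd (freeAddList N Z es) Z′ f ≈ freeAddList (freeAdd N Z′ f) Z es
freeAdd-freeAddList-comm isRank Z Z′ []       f _       _  _          = ≈-refl
freeAdd-freeAddList-comm isRank Z Z′ (e ∷ es) f Z∩Z′≡∅ Zf (Z′e ∷ Z′es) =
  ≈-trans (freeAdd-freeAddList-comm (freeAdd-isSubmodularRank Z e isRank) Z Z′ es f Z∩Z′≡∅ Zf Z′es)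
          (freeAddList-cong (freeAdd-comm isRank Z Z′ e f Z∩Z′≡∅ Zf Z′e)
                            (freeAdd-isSubmodularRank Z e (freeAdd-isSubmodularRank Z′ f isRank)) Z es)

freeAddList-comm : ∀ {N} → IsSubmodularRank N → ∀ Z Z′ es fs → Disjoint Z Z′
  → All (λ e → Z′ e ≡ false) es → All (λ f → Z f ≡ false) fs
  → freeAddList (freeAddList N Z es) Z′ fs ≈ freeAddList (freeAddList N Z′ fs) Z es
freeAddList-comm isRank Z Z′ es []       _       _    _          = ≈-refl
freeAddList-comm isRank Z Z′ es (f ∷ fs) Z∩Z′≡∅ Z′es (Zf ∷ Zfs) =
  ≈-trans (freeAddList-cong (freeAdd-freeAddList-comm isRank Z Z′ es f Z∩Z′≡∅ Zf Z′es)
                            (freeAddList-isSubmodularRank Z es (freeAdd-isSubmodularRank Z′ f isRank)) Z′ fs)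
          (freeAddList-comm (freeAdd-isSubmodularRank Z′ f isRank) Z Z′ es fs Z∩Z′≡∅ Z′es Zfs)

E-freeAddList : ∀ N Z es x → E (freeAddList N Z es) x ≡ (ofList es x ∨ E N x)
E-freeAddList N Z []       x = refl
E-freeAddList N Z (e ∷ es) x =
  trans (E-freeAddList (freeAdd N Z e) Z es x)
        (trans (sym (∨-assoc (ofList es x) (x ≡ᵇ e) (E N x)))
               (cong (_∨ E N x) (∨-comm (ofList es x) (x ≡ᵇ e))))

∈-freeAddList⁻ : ∀ N Z es {y} → y ∈ ground (freeAddList N Z es) → y ∈ es ⊎ y ∈ ground N
∈-freeAddList⁻ N Z es {y} y∈ with ofList es y in y∈es
... | true  = inj₁ (ofList⇒∈ es y∈es)
... | false = inj₂ (ofList⇒∈ (ground N) (trans (cong (_∨ E N y) (sym y∈es))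
                                             (trans (sym (E-freeAddList N Z es y)) (∈⇒ofList y∈))))

rk-freeAddList-avoiding : ∀ {N} → IsSubmodularRank N → ∀ Z es S → All (λ e → S e ≡ false) es
  → rk (freeAddList N Z es) S ≡ rk N S
rk-freeAddList-avoiding isRank Z []       S _          = refl
rk-freeAddList-avoiding {N} isRank Z (e ∷ es) S (Se ∷ Ses) =
  trans (rk-freeAddList-avoiding (freeAdd-isSubmodularRank Z e isRank) Z es S Ses)
        (trans (rk-freeAdd-≐ isRank Z e S S (λ _ _ → refl))
               (trans (cong (λ b → rk N S + contribution b (connOver N Z S)) Se) (+-identityʳ (rk N S))))

delete-cong : ∀ {N N′} → N ≈ N′ → ∀ Y → delete N Y ≈ delete N′ Y
delete-cong {N} {N′} N≈N′ Y = mk≈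
  (λ x → trans (ofList-filterᵇ _ (ground N) x)
               (trans (cong (not (Y x) ∧_) (E-≡ N≈N′ x)) (sym (ofList-filterᵇ _ (ground N′) x))))
  (λ A → rk-≡ N≈N′ (A ─ₛ Y))

delete-freeAddList : ∀ {N} → IsSubmodularRank N → ∀ Z es → (∀ y → y ∈ es → y ∉ ground N)
  → delete (freeAddList N Z es) (ofList es) ≈ N
delete-freeAddList {N} isRank Z es fresh = mk≈ E-≡′ rk-≡′
  where
  ∉es : ∀ {x} → x ∈ ground N → ofList es x ≡ false
  ∉es x∈ = ∉⇒ofList es (λ x∈es → fresh _ x∈es x∈)
  E-≡′ : ∀ x → E (delete (freeAddList N Z es) (ofList es)) x ≡ E N x
  E-≡′ x = trans (ofList-filterᵇ _ (ground (freeAddList N Z es)) x)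
                 (trans (cong (not (ofList es x) ∧_) (E-freeAddList N Z es x))
                        (lemma (ofList es x) (E N x) (λ Ex → ∉es {x} (ofList⇒∈ (ground N) Ex))))
    where
    lemma : ∀ a b → (b ≡ true → a ≡ false) → (not a ∧ (a ∨ b)) ≡ b
    lemma true  true  b⇒¬a = sym (b⇒¬a refl)
    lemma true  false _    = refl
    lemma false b     _    = refl
  rk-≡′ : ∀ A → rk (delete (freeAddList N Z es) (ofList es)) A ≡ rk N A
  rk-≡′ A = trans (rk-freeAddList-avoiding isRank Z es (A ─ₛ ofList es)
                    (tabulate λ {y} y∈ → trans (cong (λ b → A y ∧ not b) (∈⇒ofList y∈)) (∧-zeroʳ (A y))))
                  (IsSubmodularRank.rk-cong isRank _ _ λ x x∈ →
                    trans (cong (λ b → A x ∧ not b) (∉es x∈)) (∧-identityʳ (A x)))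

∈-unique⇒↭∷ : ∀ {A : Set} {x : A} {xs} → Unique xs → x ∈ xs → ∃[ ys ] (xs ↭ x ∷ ys × x ∉ ys)
∈-unique⇒↭∷ {x = x} uniq x∈ with ∈-∃++ x∈
... | as , bs , refl with Unique-resp-↭ (setoid _) (↭⇒↭ₛ (shift x as bs)) uniq
...   | x≢as++bs ∷ _ = as ++ bs , shift x as bs , λ x∈′ → All-lookup x≢as++bs x∈′ refl

module _ {n : ℕ} (Xs : Fin n → Subset) (Ys : Fin n → List ℕ) where

  seqAdd-isSubmodularRank : ∀ {N} L → IsSubmodularRank N → IsSubmodularRank (seqAdd N Xs Ys L)
  seqAdd-isSubmodularRank []      isRank = isRank
  seqAdd-isSubmodularRank (j ∷ L) isRank =
    seqAdd-isSubmodularRank L (freeAddList-isSubmodularRank (Xs j) (Ys j) isRank)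

  seqAdd-cong : ∀ {N N′} L → N ≈ N′ → IsSubmodularRank N′ → seqAdd N Xs Ys L ≈ seqAdd N′ Xs Ys L
  seqAdd-cong []      N≈N′ _       = N≈N′
  seqAdd-cong (j ∷ L) N≈N′ isRank′ =
    seqAdd-cong L (freeAddList-cong N≈N′ isRank′ (Xs j) (Ys j)) (freeAddList-isSubmodularRank (Xs j) (Ys j) isRank′)

  seqAdd-++ : ∀ N L L′ → seqAdd N Xs Ys (L ++ L′) ≡ seqAdd (seqAdd N Xs Ys L) Xs Ys L′
  seqAdd-++ N []      L′ = refl
  seqAdd-++ N (j ∷ L) L′ = seqAdd-++ (freeAddList N (Xs j) (Ys j)) L L′

  ∈-seqAdd⁻ : ∀ N L {y} → y ∈ ground (seqAdd N Xs Ys L) → y ∈ ground N ⊎ ∃[ j ] (j ∈ L × y ∈ Ys j)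
  ∈-seqAdd⁻ N []      y∈ = inj₁ y∈
  ∈-seqAdd⁻ N (j ∷ L) y∈ with ∈-seqAdd⁻ (freeAddList N (Xs j) (Ys j)) L y∈
  ... | inj₂ (k , k∈L , y∈Ysk) = inj₂ (k , there k∈L , y∈Ysk)
  ... | inj₁ y∈′ with ∈-freeAddList⁻ N (Xs j) (Ys j) y∈′
  ...   | inj₁ y∈Ysj = inj₂ (j , here refl , y∈Ysj)
  ...   | inj₂ y∈N   = inj₁ y∈N

  module _ (disjoint : ∀ i j → i ≢ j → Disjoint (Xs i) (Xs j))
           (avoids : ∀ i j → All (λ y → Xs i y ≡ false) (Ys j)) where

    freeAddList-swap : ∀ {N} → IsSubmodularRank N → ∀ j k →
      freeAddList (freeAddList N (Xs j) (Ys j)) (Xs k) (Ys k) ≈ freeAddList (freeAddList N (Xs k) (Ys k)) (Xs j) (Ys j)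
    freeAddList-swap isRank j k with j ≟ k
    ... | yes refl = ≈-refl
    ... | no  j≢k  = freeAddList-comm isRank (Xs j) (Xs k) (Ys j) (Ys k) (disjoint j k j≢k) (avoids k j) (avoids j k)

    seqAdd-↭ : ∀ {N L L′} → IsSubmodularRank N → L ↭ L′ → seqAdd N Xs Ys L ≈ seqAdd N Xs Ys L′
    seqAdd-↭ isRank Perm.refl = ≈-refl
    seqAdd-↭ isRank (prep j L↭L′) = seqAdd-↭ (freeAddList-isSubmodularRank (Xs j) (Ys j) isRank) L↭L′
    seqAdd-↭ {N} isRank (swap {L} j k L↭L′) =
      ≈-trans (seqAdd-cong L (freeAddList-swap isRank j k) isRank′) (seqAdd-↭ isRank′ L↭L′)
      where
      isRank′ : IsSubmodularRank (freeAddList (freeAddList N (Xs k) (Ys k)) (Xs j) (Ys j))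
      isRank′ = freeAddList-isSubmodularRank (Xs j) (Ys j) (freeAddList-isSubmodularRank (Xs k) (Ys k) isRank)
    seqAdd-↭ isRank (Perm.trans L↭L′ L′↭L″) = ≈-trans (seqAdd-↭ isRank L↭L′) (seqAdd-↭ isRank L′↭L″)

    seqAdd-last : ∀ {N L L′ i} → IsSubmodularRank N → L ↭ i ∷ L′
      → seqAdd N Xs Ys L ≈ freeAddList (seqAdd N Xs Ys L′) (Xs i) (Ys i)
    seqAdd-last {N} {L} {L′} {i} isRank L↭i∷L′ =
      subst (seqAdd N Xs Ys L ≈_) (seqAdd-++ N L′ [ i ]) (seqAdd-↭ isRank (↭-trans L↭i∷L′ (++-comm [ i ] L′)))

    seqAdd-re-add : ∀ {N L} i → IsSubmodularRank N → Unique L → i ∈ L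
      → (∀ y → y ∈ Ys i → y ∉ ground N) → (∀ j → i ≢ j → ∀ y → y ∈ Ys i → y ∉ Ys j)
      → seqAdd N Xs Ys L ≈ freeAddList (delete (seqAdd N Xs Ys L) (ofList (Ys i))) (Xs i) (Ys i)
    seqAdd-re-add {N} {L} i isRank uniq i∈L Ysi-fresh Ysi-disjoint with ∈-unique⇒↭∷ uniq i∈L
    ... | L′ , L↭i∷L′ , i∉L′ = ≈-trans added-last (≈-sym (freeAddList-cong deleted isRankP (Xs i) (Ys i)))
      where
      P : RankSys
      P = seqAdd N Xs Ys L′
      isRankP : IsSubmodularRank P
      isRankP = seqAdd-isSubmodularRank L′ isRank
      added-last : seqAdd N Xs Ys L ≈ freeAddList P (Xs i) (Ys i)
      added-last = seqAdd-last isRank L↭i∷L′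
      Ysi-fresh-P : ∀ y → y ∈ Ys i → y ∉ ground P
      Ysi-fresh-P y y∈Ysi y∈P with ∈-seqAdd⁻ N L′ y∈P
      ... | inj₁ y∈N               = Ysi-fresh y y∈Ysi y∈N
      ... | inj₂ (j , j∈L′ , y∈Ysj) = Ysi-disjoint j (λ { refl → i∉L′ j∈L′ }) y y∈Ysi y∈Ysj
      deleted : delete (seqAdd N Xs Ys L) (ofList (Ys i)) ≈ P
      deleted = ≈-trans (delete-cong added-last (ofList (Ys i))) (delete-freeAddList isRankP (Xs i) (Ys i) Ysi-fresh-P)

permList : ∀ {n} → Permutation′ n → List (Fin n)
permList φ = vtoList (φ ⟨$⟩ʳ_)

permList-unique : ∀ {n} (φ : Permutation′ n) → Unique (permList φ)
permList-unique φ = tabulate⁺ λ φi≡φj → trans (sym (inverseˡ φ)) (trans (cong (φ ⟨$⟩ˡ_) φi≡φj) (inverseˡ φ))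

∈-permList : ∀ {n} (φ : Permutation′ n) i → i ∈ permList φ
∈-permList φ i = subst (_∈ permList φ) (inverseʳ φ) (∈-tabulate⁺ (φ ⟨$⟩ˡ i))

permList-↭ : ∀ {n} (φ ψ : Permutation′ n) → permList ψ ↭ permList φ
permList-↭ φ ψ = ∼bag⇒↭ (unique∧set⇒bag (permList-unique ψ) (permList-unique φ)
                           (mk⇔ (λ _ → ∈-permList φ _) (λ _ → ∈-permList ψ _)))

lemma3p17 : (M : RankSys) → IsMatroid M → (n : ℕ)
  → (Xs : Fin n → Subset) → (Ys : Fin n → List ℕ)
  → (∀ i x → Xs i x ≡ true → x ∈ ground M)
  → (∀ i j → i ≢ j → ∀ x → Xs i x ≡ true → Xs j x ≡ false)
  → (∀ i → Unique (Ys i))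
  → (∀ i y → y ∈ Ys i → y ∉ ground M)
  → (∀ i j → i ≢ j → ∀ y → y ∈ Ys i → y ∉ Ys j)
  → (φ : Permutation′ n)
  → ((ψ : Permutation′ n) → Mperm M Xs Ys ψ ≅ Mperm M Xs Ys φ)
    × ((i : Fin n) → Mperm M Xs Ys φ ≅ freeAddList (delete (Mperm M Xs Ys φ) (ofList (Ys i))) (Xs i) (Ys i))
lemma3p17 M isMatroid n Xs Ys Xs⊆E Xs-disjoint _ Ys-fresh Ys-disjoint φ =
    (λ ψ → ≈⇒≅ (seqAdd-↭ Xs Ys Xs-disjoint avoids isRank (permList-↭ φ ψ)))
  , (λ i → ≈⇒≅ (seqAdd-re-add Xs Ys Xs-disjoint avoids i isRank
                  (permList-unique φ) (∈-permList φ i) (Ys-fresh i) (Ys-disjoint i)))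
  where
  isRank : IsSubmodularRank M
  isRank = isMatroid⇒isSubmodularRank isMatroid
  avoids : ∀ i j → All (λ y → Xs i y ≡ false) (Ys j)
  avoids i j = tabulate λ {y} y∈Ysj → ¬-not λ Xsiy → Ys-fresh j y y∈Ysj (Xs⊆E i y Xsiy)
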